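{- Let $j,k$ be positive integers, $H$ a graph, $H''$ a connected induced subgraph of $H$ with at most $j$ vertices, and $H'=H-V(H'')$ with $\chi(H')\leq k$. Suppose $g_k(H')\leq j$ and that $H''$ is $f^F$-choosable for every connected subgraph $F$ of $H'$ on at most $g_k(H')$ vertices. Then $g_k(H)\leq j$.
   Context: For $v\in V(H'')$ and a subgraph $F$ of $H'$: $d'(v)=|N_H(v)\cap V(H')|$, $d^F(v)=|N_H(v)\cap V(F)|$, and $f^F(v)=k-d'(v)-d^F(v)$. Given $f:V(H'')\to\mathbb{Z}$, an $f$-list assignment $L$ gives each vertex $v$ a list of $f(v)$ positive integers; an $L$-coloring is a proper coloring $\phi$ with $\phi(v)\in L(v)$; $H''$ is $f$-choosable if every $f$-list assignment admits an $L$-coloring. For a graph $H$ and $k\geq\chi(H)$, a proper $k$-coloring is a map $V(H)\to[k]$ giving adjacent vertices different colors; $G^j_k(H)$ has the proper $k$-colorings of $H$ as vertices, two distinct colorings adjacent if $H$ contains a connected subgraph on at most $j$ vertices containing all vertices where they differ; $g_k(H)$ is the least $j\geq1$ with $G^j_k(H)$ connected. -}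

module Defs where

open import Data.Nat using (ℕ; zero; suc; _+_; _≤_; _<_)
open import Data.Integer using (ℤ; +_; -[1+_]) renaming (_-_ to _-ℤ_)
open import Data.Fin using (Fin; zero; suc)
open import Data.Bool using (Bool; true; false; T; _∧_)
open import Data.List using (List; length)
open import Data.List.Relation.Unary.All using (All)
open import Data.List.Relation.Unary.Unique.Propositional using (Unique)
open import Data.List.Membership.Propositional using (_∈_)
open import Data.Product using (Σ; ∃; ∃-syntax; _×_)
open import Data.Sum using (_⊎_)
open import Function.Definitions using (Injective)
open import Relation.Binary.PropositionalEquality using (_≡_; _≢_)
open import Relation.Binary.Construct.Closure.ReflexiveTransitive using (Star)
open import Relation.Nullary using (¬_)

record Graph : Set where
  field
    n      : ℕ
    adj    : Fin n → Fin n → Bool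
    sym    : ∀ u v → adj u v ≡ adj v u
    irrefl : ∀ v → adj v v ≡ false
open Graph public

count : ∀ {m} → (Fin m → Bool) → ℕ
count {zero}  p = 0
count {suc m} p with p zero
... | true  = suc (count (λ i → p (suc i)))
... | false = count (λ i → p (suc i))

data Reach {m : ℕ} (E : Fin m → Fin m → Bool) : Fin m → Fin m → Set where
  here : ∀ {v} → Reach E v v
  step : ∀ {u w v} → T (E u w) → Reach E w v → Reach E u v

GraphConnected : Graph → Set
GraphConnected G = (0 < n G) × (∀ u v → Reach (adj G) u v)

-- (Not necessarily induced) subgraphs of a graph

record Subgraph (G : Graph) : Set where
  field
    inV    : Fin (n G) → Bool
    inE    : Fin (n G) → Fin (n G) → Bool
    E-sym  : ∀ u v → inE u v ≡ inE v u
    E⊆adj  : ∀ u v → T (inE u v) → T (adj G u v)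
    E-ends : ∀ u v → T (inE u v) → T (inV u) × T (inV v)
open Subgraph public

size : ∀ {G} → Subgraph G → ℕ
size F = count (inV F)

SubConnected : ∀ {G} → Subgraph G → Set
SubConnected {G} F =
  (∃[ v ] T (inV F v)) ×
  (∀ u v → T (inV F u) → T (inV F v) → Reach (inE F) u v)

IsProper : (G : Graph) (k : ℕ) → (Fin (n G) → Fin k) → Set
IsProper G k c = ∀ u v → T (adj G u v) → c u ≢ c v

ChromaticAtMost : Graph → ℕ → Set
ChromaticAtMost G k = Σ (Fin (n G) → Fin k) (IsProper G k)

-- adjacency in the reconfiguration graph G^j_k(G): two distinct proper
-- colourings such that G has a connected subgraph on at most j vertices
-- containing every vertex where they differ
ReconfAdj : (j k : ℕ) (G : Graph) → (Fin (n G) → Fin k) → (Fin (n G) → Fin k) → Set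
ReconfAdj j k G α β =
  IsProper G k α × IsProper G k β × (∃[ v ] α v ≢ β v) ×
  (Σ (Subgraph G) λ F → SubConnected F × size F ≤ j ×
     (∀ v → α v ≢ β v → T (inV F v)))

-- G^j_k(G) is connected: any two proper colourings are joined by a walk
-- (colourings are equal as maps, i.e. pointwise)
ReconfConnected : (j k : ℕ) (G : Graph) → Set
ReconfConnected j k G =
  ∀ α β → IsProper G k α → IsProper G k β →
    ∃[ γ ] (Star (ReconfAdj j k G) α γ × (∀ v → γ v ≡ β v))

-- g_k(G) = g  (g is the least j ≥ 1 with G^j_k(G) connected)
IsG : (k : ℕ) (G : Graph) (g : ℕ) → Set
IsG k G g = (1 ≤ g) × ReconfConnected g k G ×
            (∀ j → 1 ≤ j → j < g → ¬ ReconfConnected j k G)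

-- g_k(G) ≤ j  (the least such index exists and is ≤ j)
GLe : (k : ℕ) (G : Graph) (j : ℕ) → Set
GLe k G j = ∃[ g ] (1 ≤ g × g ≤ j × ReconfConnected g k G)

-- a list of f(v) entries; for f(v) ≤ 0 the list is empty
listSize : ℤ → ℕ
listSize (+ m)    = m
listSize -[1+ m ] = 0

IsListAssignment : (G : Graph) → (Fin (n G) → ℤ) → (Fin (n G) → List ℕ) → Set
IsListAssignment G f L =
  ∀ v → All (λ c → 1 ≤ c) (L v) × Unique (L v) × length (L v) ≡ listSize (f v)

Choosable : (G : Graph) → (Fin (n G) → ℤ) → Set
Choosable G f =
  ∀ L → IsListAssignment G f L →
    Σ (Fin (n G) → ℕ) λ φ →
      (∀ v → φ v ∈ L v) × (∀ u v → T (adj G u v) → φ u ≢ φ v)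

-- H'' an induced subgraph of H via an embedding ι'' and H' = H - V(H'')
-- via an embedding ι' (images partition V(H), adjacency is inherited)

record Split (H H'' H' : Graph) : Set where
  field
    ι''      : Fin (n H'') → Fin (n H)
    ι'       : Fin (n H') → Fin (n H)
    ι''-inj  : Injective _≡_ _≡_ ι''
    ι'-inj   : Injective _≡_ _≡_ ι'
    disjoint : ∀ a b → ι'' a ≢ ι' b
    cover    : ∀ v → (∃[ a ] ι'' a ≡ v) ⊎ (∃[ b ] ι' b ≡ v)
    adj''    : ∀ a b → adj H'' a b ≡ adj H (ι'' a) (ι'' b)
    adj'     : ∀ a b → adj H' a b ≡ adj H (ι' a) (ι' b)
open Split public

d' : ∀ {H H'' H'} → Split H H'' H' → Fin (n H'') → ℕ
d' {H} S v = count (λ w → adj H (ι'' S v) (ι' S w))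

dF : ∀ {H H'' H'} → Split H H'' H' → Subgraph H' → Fin (n H'') → ℕ
dF {H} S F v = count (λ w → inV F w ∧ adj H (ι'' S v) (ι' S w))

fF : ∀ {H H'' H'} → ℕ → Split H H'' H' → Subgraph H' → Fin (n H'') → ℤ
fF k S F v = ((+ k) -ℤ (+ d' S v)) -ℤ (+ dF S F v)

module Submission where

-- Given proper k-colourings α, β of H, take a walk γ₀ = α|H', …, γₘ = β|H'
-- in G^g_k(H') and lift it to G^j_k(H), carrying along a colouring ψ of
-- H'' compatible with the current γᵢ.  If the step γᵢ → γᵢ₊₁ changes
-- colours only inside F, forbid at each v ∈ H'' the colours of γᵢ on
-- N(v) ∩ V(H') and of γᵢ₊₁ on N(v) ∩ V(F); f^F(v) colours remain, so
-- choosability gives a recolouring ψ' of H'' compatible with both.  Then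
-- (ψ,γᵢ) → (ψ',γᵢ) changes colours only on H'' and (ψ',γᵢ) → (ψ',γᵢ₊₁)
-- only on the copy of F, connected sets of at most j vertices.

open import Defs hiding (sym)
open import Data.Nat using (ℕ; zero; suc; _≤_; _∸_; _+_; z≤n; s≤s)
import Data.Nat.Properties as ℕP
open import Data.Integer as ℤ using (ℤ; +_; -[1+_]; _⊖_)
import Data.Integer.Properties as ℤP
open import Data.Fin as Fin using (Fin; zero; suc; toℕ)
import Data.Fin.Properties as FinP
open import Data.Bool using (Bool; true; false; T; _∧_)
open import Data.Bool.Properties using (T?; T-∧)
open import Data.Unit using (tt)
open import Data.Empty using (⊥-elim)
open import Data.Product using (_×_; _,_; proj₁; proj₂; Σ; ∃; ∃-syntax)
open import Data.Sum using (inj₁; inj₂)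
open import Data.List using (List; []; _∷_; length; map; filter; take; allFin; _++_; tabulate)
import Data.List.Properties as LP
open import Data.List.Membership.Propositional using (_∈_; _∉_)
import Data.List.Membership.Propositional.Properties as MP
import Data.List.Membership.DecPropositional as DecMembership
open import Data.List.Relation.Binary.Subset.Propositional using (_⊆_)
import Data.List.Relation.Binary.Sublist.Propositional as Sublist
import Data.List.Relation.Binary.Sublist.Propositional.Properties as SublistP
open import Data.List.Relation.Unary.Any as Any using (Any; here; there)
import Data.List.Relation.Unary.All as All
import Data.List.Relation.Unary.All.Properties as AllP
open import Data.List.Relation.Unary.AllPairs using (_∷_)
open import Data.List.Relation.Unary.Unique.Propositional using (Unique)
import Data.List.Relation.Unary.Unique.Propositional.Properties as UniqueP
open import Function using (_∘_; id)
open import Function.Bundles using (Equivalence)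
open import Relation.Binary.Definitions using (DecidableEquality)
open import Relation.Binary.PropositionalEquality
open import Relation.Binary.Construct.Closure.ReflexiveTransitive using (Star; ε; _◅_)
open import Relation.Nullary using (¬_; Dec; yes; no; ¬?)
open import Relation.Nullary.Decidable using (isYes; toWitness; fromWitness; decidable-stable; _×-dec_)

unique-⊆-length : ∀ {A : Set} → DecidableEquality A →
  ∀ {xs ys : List A} → Unique xs → xs ⊆ ys → length xs ≤ length ys
unique-⊆-length _≟_ {[]} _ _ = z≤n
unique-⊆-length _≟_ {x ∷ xs} {ys} (x∉xs ∷ unique-xs) xs⊆ys =
  ℕP.≤-trans (s≤s (unique-⊆-length _≟_ unique-xs xs⊆ys-x))
             (LP.filter-notAll (λ y → ¬? (x ≟ y)) ys x∈ys)
  where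
    xs⊆ys-x : xs ⊆ filter (λ y → ¬? (x ≟ y)) ys
    xs⊆ys-x y∈xs = MP.∈-filter⁺ (λ y → ¬? (x ≟ y)) (xs⊆ys (there y∈xs)) (All.lookup x∉xs y∈xs)
    x∈ys : Any (λ y → ¬ ¬ x ≡ y) ys
    x∈ys = Any.map (λ x≡y x≢y → x≢y x≡y) (xs⊆ys (here refl))

length-filter-complement : ∀ {A : Set} {P : A → Set} (P? : ∀ x → Dec (P x)) xs →
  length (filter P? xs) + length (filter (¬? ∘ P?) xs) ≡ length xs
length-filter-complement P? [] = refl
length-filter-complement P? (x ∷ xs) with P? x
... | yes _ = cong suc (length-filter-complement P? xs)
... | no _  = trans (ℕP.+-suc _ _) (cong suc (length-filter-complement P? xs))

members : ∀ {m} → (Fin m → Bool) → List (Fin m)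
members p = filter (λ v → T? (p v)) (allFin _)

∈-members : ∀ {m} (p : Fin m → Bool) {v} → T (p v) → v ∈ members p
∈-members p {v} pv = MP.∈-filter⁺ (λ w → T? (p w)) (MP.∈-allFin v) pv

length-filter-tabulate : ∀ {m M} (h : Fin m → Fin M) (q : Fin M → Bool) →
  length (filter (λ v → T? (q v)) (tabulate h)) ≡ count (q ∘ h)
length-filter-tabulate {zero} h q = refl
length-filter-tabulate {suc m} h q with q (h zero)
... | true  = cong suc (length-filter-tabulate (h ∘ suc) q)
... | false = length-filter-tabulate (h ∘ suc) q

length-members : ∀ {m} (p : Fin m → Bool) → length (members p) ≡ count p
length-members p = length-filter-tabulate id p

count-≤-length : ∀ {m} (p : Fin m → Bool) (ys : List (Fin m)) →
  (∀ v → T (p v) → v ∈ ys) → count p ≤ length ys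
count-≤-length {m} p ys p⊆ys = subst (_≤ length ys) (length-members p)
  (unique-⊆-length Fin._≟_ (UniqueP.filter⁺ (λ v → T? (p v)) (UniqueP.allFin⁺ m))
    (λ v∈ → p⊆ys _ (proj₂ (MP.∈-filter⁻ (λ v → T? (p v)) {xs = allFin m} v∈))))

count-true : ∀ m → count {m} (λ _ → true) ≡ m
count-true zero    = refl
count-true (suc m) = cong suc (count-true m)

listSize-⊖ : ∀ m n → listSize (m ⊖ n) ≡ m ∸ n
listSize-⊖ m n with ℕP.≤-total n m
... | inj₁ n≤m = cong listSize (ℤP.⊖-≥ n≤m)
... | inj₂ m≤n = trans (cong listSize (ℤP.⊖-≤ m≤n))
                   (trans (nonpositive (n ∸ m)) (sym (ℕP.m≤n⇒m∸n≡0 m≤n)))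
  where
    nonpositive : ∀ x → listSize (ℤ.- (+ x)) ≡ 0
    nonpositive zero    = refl
    nonpositive (suc x) = refl

listSize-minus : ∀ z b → listSize (z ℤ.- + b) ≡ listSize z ∸ b
listSize-minus (+ m)    b       = trans (cong listSize (ℤP.m-n≡m⊖n m b)) (listSize-⊖ m b)
listSize-minus -[1+ m ] zero    = listSize-⊖ 0 (suc m)
listSize-minus -[1+ m ] (suc b) = refl

listSize-fF : ∀ k a b → listSize (((+ k) ℤ.- (+ a)) ℤ.- (+ b)) ≡ k ∸ (a + b)
listSize-fF k a b = begin
  listSize (((+ k) ℤ.- (+ a)) ℤ.- (+ b)) ≡⟨ listSize-minus ((+ k) ℤ.- (+ a)) b ⟩
  listSize ((+ k) ℤ.- (+ a)) ∸ b         ≡⟨ cong (_∸ b) (listSize-minus (+ k) a) ⟩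
  k ∸ a ∸ b                              ≡⟨ ℕP.∸-+-assoc k a b ⟩
  k ∸ (a + b)                            ∎
  where open ≡-Reasoning

module _ {k : ℕ} where
  open DecMembership {A = Fin k} Fin._≟_ using (_∈?_)

  avoiding : List (Fin k) → List (Fin k)
  avoiding xs = filter (λ c → ¬? (c ∈? xs)) (allFin k)

  length-avoiding : ∀ xs → k ∸ length xs ≤ length (avoiding xs)
  length-avoiding xs = ℕP.m≤n+o⇒m∸n≤o k (length xs) (begin
    k                                           ≡⟨ LP.length-tabulate id ⟨
    length (allFin k)                           ≡⟨ length-filter-complement (_∈? xs) (allFin k) ⟨
    length inside + length (avoiding xs)      ≤⟨ ℕP.+-monoˡ-≤ _ inside-short ⟩
    length xs + length (avoiding xs)            ∎)
    where
      open ℕP.≤-Reasoning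
      inside : List (Fin k)
      inside = filter (_∈? xs) (allFin k)
      inside-short : length inside ≤ length xs
      inside-short = unique-⊆-length Fin._≟_ (UniqueP.filter⁺ (_∈? xs) (UniqueP.allFin⁺ k))
        (λ c∈ → proj₂ (MP.∈-filter⁻ (_∈? xs) {xs = allFin k} c∈))

  encode : Fin k → ℕ
  encode c = suc (toℕ c)

  encode-injective : ∀ {c d} → encode c ≡ encode d → c ≡ d
  encode-injective = FinP.toℕ-injective ∘ ℕP.suc-injective

  -- If G is f-choosable and at each vertex v at most k ∸ f(v) colours
  -- are forbidden, then G has a proper k-colouring avoiding them: offer
  -- f(v) of the allowed colours as the list at v.
  choose-avoiding : (G : Graph) (f : Fin (n G) → ℤ) (forbidden : Fin (n G) → List (Fin k)) →
    (∀ v → listSize (f v) ≤ k ∸ length (forbidden v)) → Choosable G f →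
    Σ (Fin (n G) → Fin k) λ ψ → IsProper G k ψ × (∀ v → ψ v ∉ forbidden v)
  choose-avoiding G f forbidden room choosable = decode (choosable (map encode ∘ offered) lists)
    where
      offered : Fin (n G) → List (Fin k)
      offered v = take (listSize (f v)) (avoiding (forbidden v))

      offered-length : ∀ v → length (offered v) ≡ listSize (f v)
      offered-length v = trans (LP.length-take (listSize (f v)) (avoiding (forbidden v)))
        (ℕP.m≤n⇒m⊓n≡m (ℕP.≤-trans (room v) (length-avoiding (forbidden v))))

      lists : IsListAssignment G f (map encode ∘ offered)
      lists v = AllP.map⁺ (All.universal (λ _ → s≤s z≤n) (offered v))
              , UniqueP.map⁺ encode-injective (UniqueP.take⁺ (listSize (f v))
                  (UniqueP.filter⁺ (λ c → ¬? (c ∈? forbidden v)) (UniqueP.allFin⁺ k)))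
              , trans (LP.length-map encode (offered v)) (offered-length v)

      decode : (Σ (Fin (n G) → ℕ) λ φ → (∀ v → φ v ∈ map encode (offered v)) ×
                                        (∀ u v → T (adj G u v) → φ u ≢ φ v)) →
               Σ (Fin (n G) → Fin k) λ ψ → IsProper G k ψ × (∀ v → ψ v ∉ forbidden v)
      decode (φ , φ-offered , φ-proper) = ψ , ψ-proper , ψ-avoids
        where
          decoded : ∀ v → ∃ λ c → c ∈ offered v × φ v ≡ encode c
          decoded v = MP.∈-map⁻ encode (φ-offered v)

          ψ : Fin (n G) → Fin k
          ψ v = proj₁ (decoded v)

          ψ-proper : IsProper G k ψ
          ψ-proper u v uv ψu≡ψv = φ-proper u v uv
            (trans (proj₂ (proj₂ (decoded u))) (trans (cong encode ψu≡ψv) (sym (proj₂ (proj₂ (decoded v))))))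

          ψ-avoids : ∀ v → ψ v ∉ forbidden v
          ψ-avoids v = proj₂ (MP.∈-filter⁻ (λ c → ¬? (c ∈? forbidden v)) {xs = allFin k}
            (Sublist.lookup (SublistP.take-⊆ (listSize (f v)) (avoiding (forbidden v))) (proj₁ (proj₂ (decoded v)))))

T-extensional : ∀ {x y} → (T x → T y) → (T y → T x) → x ≡ y
T-extensional {false} {false} _ _ = refl
T-extensional {false} {true}  _ y⇒x = ⊥-elim (y⇒x tt)
T-extensional {true}  {false} x⇒y _ = ⊥-elim (x⇒y tt)
T-extensional {true}  {true}  _ _ = refl

whole : (G : Graph) → Subgraph G
whole G = record
  { inV = λ _ → true ; inE = adj G ; E-sym = Graph.sym G
  ; E⊆adj = λ _ _ e → e ; E-ends = λ _ _ _ → tt , tt }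

whole-connected : ∀ {G} → GraphConnected G → SubConnected (whole G)
whole-connected (0<n , walk) = (Fin.fromℕ< 0<n , tt) , λ u v _ _ → walk u v

module Image {G H : Graph} (ι : Fin (n G) → Fin (n H))
             (ι-hom : ∀ a b → T (adj G a b) → T (adj H (ι a) (ι b)))
             (F : Subgraph G) where

  InV : Fin (n H) → Set
  InV v = ∃[ a ] (ι a ≡ v × T (inV F a))

  InE : Fin (n H) → Fin (n H) → Set
  InE u v = ∃[ a ] ∃[ b ] (ι a ≡ u × ι b ≡ v × T (inE F a b))

  InV? : ∀ v → Dec (InV v)
  InV? v = FinP.any? (λ a → (ι a Fin.≟ v) ×-dec T? (inV F a))

  InE? : ∀ u v → Dec (InE u v)
  InE? u v = FinP.any? λ a → FinP.any? λ b → (ι a Fin.≟ u) ×-dec ((ι b Fin.≟ v) ×-dec T? (inE F a b))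

  InE-sym : ∀ {u v} → InE u v → InE v u
  InE-sym (a , b , ιa≡u , ιb≡v , ab) = b , a , ιb≡v , ιa≡u , subst T (E-sym F a b) ab

  InE⇒adj : ∀ {u v} → InE u v → T (adj H u v)
  InE⇒adj (a , b , refl , refl , ab) = ι-hom a b (E⊆adj F a b ab)

  InE⇒ends : ∀ {u v} → InE u v → T (isYes (InV? u)) × T (isYes (InV? v))
  InE⇒ends (a , b , ιa≡u , ιb≡v , ab) =
    fromWitness (a , ιa≡u , proj₁ (E-ends F a b ab)) , fromWitness (b , ιb≡v , proj₂ (E-ends F a b ab))

  image : Subgraph H
  image = record
    { inV    = λ v → isYes (InV? v)
    ; inE    = λ u v → isYes (InE? u v)
    ; E-sym  = λ u v → T-extensional (fromWitness ∘ InE-sym ∘ toWitness) (fromWitness ∘ InE-sym ∘ toWitness)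
    ; E⊆adj  = λ u v → InE⇒adj ∘ toWitness
    ; E-ends = λ u v → InE⇒ends ∘ toWitness }

  image-vertex : ∀ {a} → T (inV F a) → T (inV image (ι a))
  image-vertex {a} Fa = fromWitness (a , refl , Fa)

  image-walk : ∀ {a b} → Reach (inE F) a b → Reach (inE image) (ι a) (ι b)
  image-walk here = here
  image-walk {a} (step {w = w} aw walk) = step (fromWitness (a , w , refl , refl , aw)) (image-walk walk)

  image-connected : SubConnected F → SubConnected image
  image-connected ((a , Fa) , walk) = (ι a , image-vertex Fa) , λ u v Iu Iv →
    walk-between (toWitness Iu) (toWitness Iv)
    where
      walk-between : ∀ {u v} → InV u → InV v → Reach (inE image) u v
      walk-between (a , refl , Fa) (b , refl , Fb) = image-walk (walk a b Fa Fb)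

  image-size : size image ≤ size F
  image-size = subst (size image ≤_)
    (trans (LP.length-map ι (members (inV F))) (length-members (inV F)))
    (count-≤-length (inV image) (map ι (members (inV F))) (λ v → covered ∘ toWitness))
    where
      covered : ∀ {v} → InV v → v ∈ map ι (members (inV F))
      covered (a , refl , Fa) = MP.∈-map⁺ ι (∈-members (inV F) Fa)

module SplitColourings {H H'' H' : Graph} (S : Split H H'' H') (k : ℕ) where

  ι''-hom : ∀ a b → T (adj H'' a b) → T (adj H (ι'' S a) (ι'' S b))
  ι''-hom a b = subst T (adj'' S a b)

  ι'-hom : ∀ a b → T (adj H' a b) → T (adj H (ι' S a) (ι' S b))
  ι'-hom a b = subst T (adj' S a b)

  H''-in-H : Subgraph H
  H''-in-H = Image.image {H''} {H} (ι'' S) ι''-hom (whole H'')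

  F-in-H : Subgraph H' → Subgraph H
  F-in-H = Image.image {H'} {H} (ι' S) ι'-hom

  H''-in-H-connected : GraphConnected H'' → SubConnected H''-in-H
  H''-in-H-connected = Image.image-connected {H''} {H} (ι'' S) ι''-hom (whole H'') ∘ whole-connected {H''}

  F-in-H-connected : ∀ {F} → SubConnected F → SubConnected (F-in-H F)
  F-in-H-connected {F} = Image.image-connected {H'} {H} (ι' S) ι'-hom F

  F-in-H-small : ∀ F → size (F-in-H F) ≤ size F
  F-in-H-small = Image.image-size {H'} {H} (ι' S) ι'-hom

  H''-in-H-small : size H''-in-H ≤ n H''
  H''-in-H-small = subst (size H''-in-H ≤_) (count-true (n H''))
    (Image.image-size {H''} {H} (ι'' S) ι''-hom (whole H''))

  by-side : (P : Fin (n H) → Set) → (∀ a → P (ι'' S a)) → (∀ b → P (ι' S b)) → ∀ v → P v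
  by-side P on'' on' v with cover S v
  ... | inj₁ (a , refl) = on'' a
  ... | inj₂ (b , refl) = on' b

  Compatible : (Fin (n H'') → Fin k) → (Fin (n H') → Fin k) → Set
  Compatible ψ γ = ∀ a b → T (adj H (ι'' S a) (ι' S b)) → ψ a ≢ γ b

  restrict''-proper : ∀ {c} → IsProper H k c → IsProper H'' k (c ∘ ι'' S)
  restrict''-proper c-proper a b ab = c-proper _ _ (ι''-hom a b ab)

  restrict'-proper : ∀ {c} → IsProper H k c → IsProper H' k (c ∘ ι' S)
  restrict'-proper c-proper a b ab = c-proper _ _ (ι'-hom a b ab)

  restrictions-compatible : ∀ {c} → IsProper H k c → Compatible (c ∘ ι'' S) (c ∘ ι' S)
  restrictions-compatible c-proper a b ab = c-proper _ _ ab

  glue : (Fin (n H'') → Fin k) → (Fin (n H') → Fin k) → Fin (n H) → Fin k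
  glue ψ γ v with cover S v
  ... | inj₁ (a , _) = ψ a
  ... | inj₂ (b , _) = γ b

  glue-ι'' : ∀ {ψ γ} a → glue ψ γ (ι'' S a) ≡ ψ a
  glue-ι'' {ψ} a with cover S (ι'' S a)
  ... | inj₁ (a' , ιa'≡ιa) = cong ψ (ι''-inj S ιa'≡ιa)
  ... | inj₂ (b , ιb≡ιa)   = ⊥-elim (disjoint S a b (sym ιb≡ιa))

  glue-ι' : ∀ {ψ γ} b → glue ψ γ (ι' S b) ≡ γ b
  glue-ι' {γ = γ} b with cover S (ι' S b)
  ... | inj₁ (a , ιa≡ιb)   = ⊥-elim (disjoint S a b ιa≡ιb)
  ... | inj₂ (b' , ιb'≡ιb) = cong γ (ι'-inj S ιb'≡ιb)

  glue-restrictions : ∀ c v → c v ≡ glue (c ∘ ι'' S) (c ∘ ι' S) v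
  glue-restrictions c = by-side (λ v → c v ≡ glue (c ∘ ι'' S) (c ∘ ι' S) v) (sym ∘ glue-ι'') (sym ∘ glue-ι')

  glue-proper : ∀ {ψ γ} → IsProper H'' k ψ → IsProper H' k γ → Compatible ψ γ → IsProper H k (glue ψ γ)
  glue-proper {ψ} {γ} ψ-proper γ-proper compatible = by-side (λ u → ∀ v → ProperEdge u v) from'' from'
    where
      ProperEdge : Fin (n H) → Fin (n H) → Set
      ProperEdge u v = T (adj H u v) → glue ψ γ u ≢ glue ψ γ v

      from'' : ∀ a v → ProperEdge (ι'' S a) v
      from'' a = by-side (ProperEdge (ι'' S a))
        (λ a' aa' → subst₂ _≢_ (sym (glue-ι'' a)) (sym (glue-ι'' a')) (ψ-proper a a' (subst T (sym (adj'' S a a')) aa')))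
        (λ b ab → subst₂ _≢_ (sym (glue-ι'' a)) (sym (glue-ι' b)) (compatible a b ab))

      from' : ∀ b v → ProperEdge (ι' S b) v
      from' b = by-side (ProperEdge (ι' S b))
        (λ a ba → subst₂ _≢_ (sym (glue-ι' b)) (sym (glue-ι'' a))
                    (≢-sym (compatible a b (subst T (Graph.sym H (ι' S b) (ι'' S a)) ba))))
        (λ b' bb' → subst₂ _≢_ (sym (glue-ι' b)) (sym (glue-ι' b')) (γ-proper b b' (subst T (sym (adj' S b b')) bb')))

  differ-in-H'' : ∀ (c d : Fin (n H) → Fin k) → (∀ b → c (ι' S b) ≡ d (ι' S b)) →
    ∀ v → c v ≢ d v → T (inV H''-in-H v)
  differ-in-H'' c d agree = by-side (λ v → c v ≢ d v → T (inV H''-in-H v))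
    (λ a _ → Image.image-vertex {H''} {H} (ι'' S) ι''-hom (whole H'') tt)
    (λ b c≢d → ⊥-elim (c≢d (agree b)))

  differ-in-F : ∀ F (c d : Fin (n H) → Fin k) → (∀ a → c (ι'' S a) ≡ d (ι'' S a)) →
    (∀ b → c (ι' S b) ≢ d (ι' S b) → T (inV F b)) →
    ∀ v → c v ≢ d v → T (inV (F-in-H F) v)
  differ-in-F F c d agree inside = by-side (λ v → c v ≢ d v → T (inV (F-in-H F) v))
    (λ a c≢d → ⊥-elim (c≢d (agree a)))
    (λ b c≢d → Image.image-vertex {H'} {H} (ι' S) ι'-hom F (inside b c≢d))

  -- At v ∈ H'' forbid the colours γ(N(v) ∩ V(H')) and γ₁(N(v) ∩ V(F));
  -- these are d'(v) + d^F(v) colours, leaving room for f^F(v).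
  recolour-H'' : ∀ (γ γ₁ : Fin (n H') → Fin k) F → (∀ b → γ b ≢ γ₁ b → T (inV F b)) →
    Choosable H'' (fF k S F) →
    Σ (Fin (n H'') → Fin k) λ ψ → IsProper H'' k ψ × Compatible ψ γ × Compatible ψ γ₁
  recolour-H'' γ γ₁ F inside choosable = make-compatible (choose-avoiding H'' (fF k S F) forbidden room choosable)
    where
      N' : Fin (n H'') → Fin (n H') → Bool
      N' a w = adj H (ι'' S a) (ι' S w)

      NF : Fin (n H'') → Fin (n H') → Bool
      NF a w = inV F w ∧ N' a w

      forbidden : Fin (n H'') → List (Fin k)
      forbidden a = map γ (members (N' a)) ++ map γ₁ (members (NF a))

      forbidden-length : ∀ a → length (forbidden a) ≡ d' S a + dF S F a
      forbidden-length a = trans (LP.length-++ (map γ (members (N' a))))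
        (cong₂ _+_ (trans (LP.length-map γ (members (N' a))) (length-members (N' a)))
                   (trans (LP.length-map γ₁ (members (NF a))) (length-members (NF a))))

      room : ∀ a → listSize (fF k S F a) ≤ k ∸ length (forbidden a)
      room a = ℕP.≤-reflexive (trans (listSize-fF k (d' S a) (dF S F a)) (cong (k ∸_) (sym (forbidden-length a))))

      make-compatible : (Σ (Fin (n H'') → Fin k) λ ψ → IsProper H'' k ψ × (∀ a → ψ a ∉ forbidden a)) →
        Σ (Fin (n H'') → Fin k) λ ψ → IsProper H'' k ψ × Compatible ψ γ × Compatible ψ γ₁
      make-compatible (ψ , ψ-proper , ψ-avoids) = ψ , ψ-proper , compatible , compatible₁
        where
          compatible : Compatible ψ γ
          compatible a b ab ψa≡γb = ψ-avoids a (subst (_∈ forbidden a) (sym ψa≡γb)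
            (MP.∈-++⁺ˡ (MP.∈-map⁺ γ (∈-members (N' a) ab))))

          compatible₁ : Compatible ψ γ₁
          compatible₁ a b ab with T? (inV F b)
          ... | yes Fb = λ ψa≡γ₁b → ψ-avoids a (subst (_∈ forbidden a) (sym ψa≡γ₁b)
                  (MP.∈-++⁺ʳ (map γ (members (N' a)))
                    (MP.∈-map⁺ γ₁ (∈-members (NF a) (Equivalence.from T-∧ (Fb , ab))))))
          -- a neighbour outside F keeps its colour γ b = γ₁ b
          ... | no ¬Fb = subst (ψ a ≢_) (decidable-stable (γ b Fin.≟ γ₁ b) (¬Fb ∘ inside b)) (compatible a b ab)

module Moves (j k : ℕ) (G : Graph) where

  Colouring : Set
  Colouring = Fin (n G) → Fin k

  Reaches : Colouring → Colouring → Set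
  Reaches β c = ∃[ δ ] (Star (ReconfAdj j k G) c δ × (∀ v → δ v ≡ β v))

  reaches-self : ∀ {β} → Reaches β β
  reaches-self {β} = β , ε , λ _ → refl

  reaches-cong : ∀ {β c c'} → (∀ v → c v ≡ c' v) → Reaches β c' → Reaches β c
  reaches-cong {c = c} c≗c' (δ , ε , δ≗β) = c , ε , λ v → trans (c≗c' v) (δ≗β v)
  reaches-cong {c = c} c≗c' (δ , (c'-proper , x-proper , (v , c'v≢xv) , F , F-conn , F-small , inside) ◅ walk , δ≗β) =
    δ , (c-proper , x-proper , (v , c'v≢xv ∘ trans (sym (c≗c' v))) , F , F-conn , F-small ,
         λ w cw≢xw → inside w (cw≢xw ∘ trans (c≗c' w))) ◅ walk , δ≗β
    where
      c-proper : IsProper G k c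
      c-proper u w uw cu≡cw = c'-proper u w uw (trans (sym (c≗c' u)) (trans cu≡cw (c≗c' w)))

  -- Recolouring inside a connected subgraph on at most j vertices is a
  -- move (or no change at all).
  move : ∀ {β c d} → IsProper G k c → IsProper G k d →
    (F : Subgraph G) → SubConnected F → size F ≤ j → (∀ v → c v ≢ d v → T (inV F v)) →
    Reaches β d → Reaches β c
  move {c = c} {d} c-proper d-proper F F-conn F-small inside (δ , walk , δ≗β)
    with FinP.all? (λ v → c v Fin.≟ d v)
  ... | yes c≗d = reaches-cong c≗d (δ , walk , δ≗β)
  ... | no c≉d  = δ , (c-proper , d-proper , FinP.¬∀⟶∃¬ _ _ (λ v → c v Fin.≟ d v) c≉d ,
                       F , F-conn , F-small , inside) ◅ walk , δ≗β

module Lifting (j k : ℕ) {H H'' H' : Graph} (S : Split H H'' H')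
  (H''-connected : GraphConnected H'') (H''-small : n H'' ≤ j)
  (g : ℕ) (g≤j : g ≤ j)
  (choosable : (F : Subgraph H') → SubConnected F → size F ≤ g → Choosable H'' (fF k S F))
  (β : Fin (n H) → Fin k) (β-proper : IsProper H k β) where

  open SplitColourings S k
  open Moves j k H

  move-H'' : ∀ {c d} → IsProper H k c → IsProper H k d → (∀ b → c (ι' S b) ≡ d (ι' S b)) →
    Reaches β d → Reaches β c
  move-H'' {c} {d} c-proper d-proper agree = move c-proper d-proper H''-in-H
    (H''-in-H-connected H''-connected)
    (ℕP.≤-trans H''-in-H-small H''-small) (differ-in-H'' c d agree)

  -- A step γ → γ₁ of G^g_k(H') changing colours only inside F lifts, given
  -- a recolouring ψ' of H'' compatible with γ and γ₁, to the two moves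
  -- (ψ,γ) → (ψ',γ) (inside H'') and (ψ',γ) → (ψ',γ₁) (inside the copy of F).
  lift-step : ∀ {γ γ₁ ψ ψ'} F → SubConnected F → size F ≤ g → (∀ b → γ b ≢ γ₁ b → T (inV F b)) →
    IsProper H'' k ψ → IsProper H'' k ψ' → IsProper H' k γ → IsProper H' k γ₁ →
    Compatible ψ γ → Compatible ψ' γ → Compatible ψ' γ₁ →
    Reaches β (glue ψ' γ₁) → Reaches β (glue ψ γ)
  lift-step F F-conn F-small inside ψ-proper ψ'-proper γ-proper γ₁-proper compatible compatible' compatible₁' =
    move-H'' (glue-proper ψ-proper γ-proper compatible) (glue-proper ψ'-proper γ-proper compatible')
      (λ b → trans (glue-ι' b) (sym (glue-ι' b)))
    ∘ move (glue-proper ψ'-proper γ-proper compatible') (glue-proper ψ'-proper γ₁-proper compatible₁')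
        (F-in-H F) (F-in-H-connected {F} F-conn) (ℕP.≤-trans (F-in-H-small F) (ℕP.≤-trans F-small g≤j))
        (differ-in-F F _ _ (λ a → trans (glue-ι'' a) (sym (glue-ι'' a)))
                           (λ b differ → inside b (subst₂ _≢_ (glue-ι' b) (glue-ι' b) differ)))

  lift-walk : ∀ {γ δ} → Star (ReconfAdj g k H') γ δ → (∀ b → δ b ≡ β (ι' S b)) →
    ∀ ψ → IsProper H'' k ψ → IsProper H' k γ → Compatible ψ γ → Reaches β (glue ψ γ)
  lift-walk ε δ≗β ψ ψ-proper γ-proper compatible =
    move-H'' (glue-proper ψ-proper γ-proper compatible) β-proper
      (λ b → trans (glue-ι' b) (δ≗β b)) reaches-self
  lift-walk {γ} ((_ , γ₁-proper , _ , F , F-conn , F-small , inside) ◅ walk) δ≗β ψ ψ-proper γ-proper compatible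
    with recolour-H'' γ _ F inside (choosable F F-conn F-small)
  ... | ψ' , ψ'-proper , compatible' , compatible₁' =
    lift-step F F-conn F-small inside ψ-proper ψ'-proper γ-proper γ₁-proper compatible compatible' compatible₁'
      (lift-walk walk δ≗β ψ' ψ'-proper γ₁-proper compatible₁')

mainTheorem6 : (j k : ℕ) → 1 ≤ j → 1 ≤ k →
    (H H'' H' : Graph) → (S : Split H H'' H') →
    GraphConnected H'' → n H'' ≤ j →
    ChromaticAtMost H' k →
    (g : ℕ) → IsG k H' g → g ≤ j →
    ((F : Subgraph H') → SubConnected F → size F ≤ g → Choosable H'' (fF k S F)) →
    GLe k H j
-- G^j_k(H) is connected: restrict α to H'' and H', walk from α|H' to β|H'
-- in G^g_k(H') and lift the walk.
mainTheorem6 j k 1≤j _ H H'' H' S H''-connected H''-small _ g (_ , H'-reconf-connected , _) g≤j choosable =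
  j , 1≤j , ℕP.≤-refl , H-reconf-connected
  where
    open SplitColourings S k

    H-reconf-connected : ReconfConnected j k H
    H-reconf-connected α β α-proper β-proper
      with H'-reconf-connected (α ∘ ι' S) (β ∘ ι' S)
             (restrict'-proper α-proper) (restrict'-proper β-proper)
    ... | _ , walk , end =
      Moves.reaches-cong j k H (glue-restrictions α)
        (Lifting.lift-walk j k S H''-connected H''-small g g≤j choosable β β-proper walk end
          (α ∘ ι'' S) (restrict''-proper α-proper) (restrict'-proper α-proper) (restrictions-compatible α-proper))
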